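{- Let $I=[b,i,a:\varnothing]$ be a Low ICS of $[2]\times[n]$ (so $i\ge1$, $b+i+a=n$). Then $\mathrm{Row}^{a+1}(I)=[\varnothing:a,b+1,i-1]$ (a High ICS), and none of $\mathrm{Row}^k(I)$ for $1\le k\le a$ is a High or Low ICS.
   Context: $[2]\times[n]=\{(i,j): i\in\{1,2\},1\le j\le n\}$ with the componentwise order; lower chain $\{1\}\times[n]$, upper chain $\{2\}\times[n]$. An interval-closed set (ICS) is a subset $I$ with $x,y\in I$, $x\le z\le y\Rightarrow z\in I$. The toggle $t_x$ sends $I$ to $I\triangle\{x\}$ if this is an ICS, and to $I$ otherwise; rowmotion is $\mathrm{Row}=t_{x_1}\circ\cdots\circ t_{x_N}$ for any linear extension $x_1,\dots,x_N$ (toggles applied top to bottom). For nonnegative $b+i+a=n$, $[b,i,a:\varnothing]=\{(1,j): b<j\le b+i\}$ and $[\varnothing:b,i,a]=\{(2,j): b<j\le b+i\}$. A Low ICS is a nonempty ICS contained in the lower chain; a High ICS is a nonempty ICS contained in the upper chain. -}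

module Defs where

open import Data.Bool using (Bool; true; false; _∧_; _∨_; not; if_then_else_; T)
open import Data.Nat using (ℕ; zero; suc; _+_; _<ᵇ_; _≤ᵇ_)
open import Data.Fin using (Fin; toℕ) renaming (zero to fz; suc to fs)
open import Data.Fin.Properties using (_≟_)
open import Data.Vec using (Vec; []; _∷_; lookup; tabulate; updateAt; allFin; toList)
open import Data.List using (List; []; _∷_; concatMap)
open import Data.Bool.ListAction using (all; any)
open import Data.Product using (_×_; _,_; proj₁; proj₂)
open import Relation.Nullary.Decidable using (does)
open import Function using (_∘_)

-- A subset of [2] × [n], given by its characteristic vectors on the
-- lower chain {1} × [n] and the upper chain {2} × [n].
-- Index j : Fin n stands for the element with second coordinate toℕ j + 1.
Subset2n : ℕ → Set
Subset2n n = Vec Bool n × Vec Bool n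

-- Elements of [2] × [n]: first component false = row 1 (lower), true = row 2 (upper).
Elt : ℕ → Set
Elt n = Bool × Fin n

mem : ∀ {n} → Subset2n n → Elt n → Bool
mem (lo , up) (false , j) = lookup lo j
mem (lo , up) (true  , j) = lookup up j

rowLeq : Bool → Bool → Bool
rowLeq false _     = true
rowLeq true  true  = true
rowLeq true  false = false

leq : ∀ {n} → Elt n → Elt n → Bool
leq (c , j) (c' , j') = rowLeq c c' ∧ (toℕ j ≤ᵇ toℕ j')

-- all elements, listed along the linear extension
-- (1,1),(2,1),(1,2),(2,2),...,(1,n),(2,n)
elements : ∀ n → List (Elt n)
elements n = concatMap (λ j → (false , j) ∷ (true , j) ∷ []) (toList (allFin n))

_⇒ᵇ_ : Bool → Bool → Bool
x ⇒ᵇ y = not x ∨ y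

isICS : ∀ {n} → Subset2n n → Bool
isICS {n} S =
  all (λ x → all (λ y → all (λ z →
        (mem S x ∧ mem S y ∧ leq x z ∧ leq z y) ⇒ᵇ mem S z)
      (elements n)) (elements n)) (elements n)

ICS : ∀ {n} → Subset2n n → Set
ICS S = T (isICS S)

flip : ∀ {n} → Elt n → Subset2n n → Subset2n n
flip (false , j) (lo , up) = (updateAt lo j not , up)
flip (true  , j) (lo , up) = (lo , updateAt up j not)

toggle : ∀ {n} → Elt n → Subset2n n → Subset2n n
toggle x S = if isICS (flip x S) then flip x S else S

-- apply t_{x_1} ∘ ⋯ ∘ t_{x_N} to S (so t_{x_N} acts first)
toggleSeq : ∀ {n} → List (Elt n) → Subset2n n → Subset2n n
toggleSeq []       S = S
toggleSeq (x ∷ xs) S = toggle x (toggleSeq xs S)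

Row : ∀ {n} → Subset2n n → Subset2n n
Row {n} = toggleSeq (elements n)

iter : ∀ {A : Set} → ℕ → (A → A) → A → A
iter zero    f x = x
iter (suc k) f x = f (iter k f x)

-- characteristic vector of {j : b < j ≤ b + i} (1-based j)
intervalVec : (n b i : ℕ) → Vec Bool n
intervalVec n b i = tabulate (λ j → (b <ᵇ suc (toℕ j)) ∧ (suc (toℕ j) ≤ᵇ b + i))

allFalse : ∀ n → Vec Bool n
allFalse n = tabulate (λ _ → false)

lowSet : (b i a : ℕ) → Subset2n (b + i + a)
lowSet b i a = (intervalVec (b + i + a) b i , allFalse (b + i + a))

-- [∅ : b,i,a] ⊆ [2] × [n]  (used when b + i + a = n; the index a is
-- determined by n, b, i and so is not an argument)
highSet : (n b i : ℕ) → Subset2n n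
highSet n b i = (allFalse n , intervalVec n b i)

nonempty : ∀ {n} → Subset2n n → Set
nonempty {n} S = T (any (mem S) (elements n))

inLower : ∀ {n} → Subset2n n → Set
inLower {n} S = T (all (λ j → not (mem S (true , j))) (toList (allFin n)))

inUpper : ∀ {n} → Subset2n n → Set
inUpper {n} S = T (all (λ j → not (mem S (false , j))) (toList (allFin n)))

LowICS : ∀ {n} → Subset2n n → Set
LowICS S = ICS S × nonempty S × inLower S

HighICS : ∀ {n} → Subset2n n → Set
HighICS S = ICS S × nonempty S × inUpper S

module Submission where

-- Every set on the orbit, starting with [b , b + i⟩ and
-- [b , b⟩, has lower row [c , h⟩ and upper row [d , c⟩ with d ≤ c < h.
-- Rowmotion toggles column by column from the top, the upper element of a
-- column first. Above column c the only successful toggles lengthen the lower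
-- row by the column h (if h < n) or, if h = n, shorten it down to
-- [c , c + 1⟩; column c passes from the lower row to the upper one; below c
-- the only successful toggle removes the column d from the upper row, or, if
-- the upper row was empty, every column is added to it. So while h < n one
-- rowmotion gives [c + 1 , h + 1⟩ and [d + 1 , c + 1⟩ (or [0 , c + 1⟩ if
-- d = c), and once h = n it empties the lower row. Each toggle is settled by
-- an interval-closed description of the toggled set, or by a triple
-- x ≤ z ≤ y of it with x and y in the set and z not.

open import Defs
open import Data.Bool using (Bool; true; false; _∧_; not; T)
open import Data.Bool.ListAction using (all)
open import Data.Bool.Properties using (T-∧; T-≡; ¬-not; not-involutive)
open import Data.Fin using (Fin; toℕ; fromℕ<)
open import Data.Fin.Properties using (toℕ-injective; toℕ-fromℕ<) renaming (_≟_ to _≟ᶠ_)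
open import Data.List using (List; []; _∷_; _++_; concatMap)
open import Data.List.Membership.Propositional using (_∈_)
open import Data.List.Membership.Propositional.Properties using (∈-concatMap⁺)
import Data.List.Relation.Unary.All as All
open import Data.List.Relation.Unary.All.Properties using (all⁺; all⁻)
open import Data.List.Relation.Unary.Any as Any using (here; there)
open import Data.Nat using (ℕ; zero; suc; _+_; _≤_; _<_; z≤n; s≤s; z<s; _≤ᵇ_; _<ᵇ_)
open import Data.Nat.Properties
open import Data.Nat.Tactic.RingSolver using (solve-∀)
open import Data.Product using (Σ; _×_; _,_; proj₁; proj₂)
open import Data.Sum using (inj₁; inj₂)
open import Data.Unit using (tt)
open import Data.Vec using (Vec; lookup; tabulate; updateAt; allFin; toList)
open import Data.Vec.Membership.Propositional.Properties using (∈-allFin⁺; ∈-toList⁺)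
open import Data.Vec.Properties
  using (lookup∘tabulate; tabulate∘lookup; tabulate-cong; lookup∘updateAt; lookup∘updateAt′)
open import Function using (_∘_; Equivalence)
open import Relation.Binary.PropositionalEquality
open import Relation.Nullary using (¬_; yes; no; contradiction)

open Equivalence using (to; from)

¬T⇒T-not : ∀ {b} → ¬ T b → T (not b)
¬T⇒T-not {false} _ = tt
¬T⇒T-not {true} ¬t = contradiction tt ¬t

T-not⇒¬T : ∀ {b} → T (not b) → ¬ T b
T-not⇒¬T {false} _ ()

T-ext : ∀ {a b} → (T a → T b) → (T b → T a) → a ≡ b
T-ext {false} {false} _ _ = refl
T-ext {false} {true} _ b⇒a = contradiction (b⇒a tt) λ ()
T-ext {true} {false} a⇒b _ = contradiction (a⇒b tt) λ ()
T-ext {true} {true} _ _ = refl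

⇒ᵇ-intro : ∀ {a b} → (T a → T b) → T (a ⇒ᵇ b)
⇒ᵇ-intro {false} _ = tt
⇒ᵇ-intro {true} a⇒b = a⇒b tt

⇒ᵇ-elim : ∀ {a b} → T (a ⇒ᵇ b) → T a → T b
⇒ᵇ-elim {true} t _ = t

-- k is a 0-based column: the test is that of intervalVec at position k + 1.
opaque
  [_,_⟩ : ℕ → ℕ → ℕ → Bool
  [ lo , hi ⟩ k = (lo <ᵇ suc k) ∧ (suc k ≤ᵇ hi)

  ∈-interval : ∀ {lo hi k} → lo ≤ k → k < hi → T ([ lo , hi ⟩ k)
  ∈-interval lo≤k k<hi = from T-∧ (<⇒<ᵇ (s≤s lo≤k) , ≤⇒≤ᵇ k<hi)

  interval-bounds : ∀ {lo hi k} → T ([ lo , hi ⟩ k) → lo ≤ k × k < hi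
  interval-bounds {lo} {hi} {k} t =
    let lo<k+1 , k+1≤hi = to (T-∧ {lo <ᵇ suc k}) t
    in ≤-pred (<ᵇ⇒< lo (suc k) lo<k+1) , ≤ᵇ⇒≤ (suc k) hi k+1≤hi

  lookup-intervalVec : ∀ n b i (j : Fin n) →
    lookup (intervalVec n b i) j ≡ [ b , b + i ⟩ (toℕ j)
  lookup-intervalVec n b i j = lookup∘tabulate _ j

∉-interval-below : ∀ {lo hi k} → k < lo → T (not ([ lo , hi ⟩ k))
∉-interval-below k<lo = ¬T⇒T-not λ t → <⇒≱ k<lo (proj₁ (interval-bounds t))

∉-interval-above : ∀ {lo hi k} → hi ≤ k → T (not ([ lo , hi ⟩ k))
∉-interval-above hi≤k = ¬T⇒T-not λ t → <⇒≱ (proj₂ (interval-bounds t)) hi≤k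

empty-interval : ∀ m k → [ m , m ⟩ k ≡ false
empty-interval m k = T-ext (λ t → let m≤k , k<m = interval-bounds t in <⇒≱ k<m m≤k) λ ()

interval-convex : ∀ {lo hi p q s} → p ≤ q → q ≤ s →
  T ([ lo , hi ⟩ p) → T ([ lo , hi ⟩ s) → T ([ lo , hi ⟩ q)
interval-convex p≤q q≤s tp ts =
  ∈-interval (≤-trans (proj₁ (interval-bounds tp)) p≤q) (≤-<-trans q≤s (proj₂ (interval-bounds ts)))

Flip : ℕ → (ℕ → Bool) → (ℕ → Bool) → Set
Flip m f g = g m ≡ not (f m) × (∀ k → k ≢ m → g k ≡ f k)

Flip-sym : ∀ {m f g} → Flip m f g → Flip m g f
Flip-sym {m} {f} (at , off) =
  sym (trans (cong not at) (not-involutive (f m))) , λ k k≢m → sym (off k k≢m)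

flip-top : ∀ {lo hi} → lo ≤ hi → Flip hi [ lo , hi ⟩ [ lo , suc hi ⟩
flip-top lo≤hi =
  T-ext (λ _ → ∉-interval-above ≤-refl) (λ _ → ∈-interval lo≤hi ≤-refl) ,
  λ k k≢hi → T-ext
    (λ t → let lo≤k , k<hi+1 = interval-bounds t
           in ∈-interval lo≤k (≤∧≢⇒< (≤-pred k<hi+1) k≢hi))
    (λ t → let lo≤k , k<hi = interval-bounds t in ∈-interval lo≤k (m<n⇒m<1+n k<hi))

flip-bottom : ∀ {lo hi} → lo < hi → Flip lo [ suc lo , hi ⟩ [ lo , hi ⟩
flip-bottom lo<hi =
  T-ext (λ _ → ∉-interval-below ≤-refl) (λ _ → ∈-interval ≤-refl lo<hi) ,
  λ k k≢lo → T-ext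
    (λ t → let lo≤k , k<hi = interval-bounds t in ∈-interval (≤∧≢⇒< lo≤k (k≢lo ∘ sym)) k<hi)
    (λ t → let lo<k , k<hi = interval-bounds t in ∈-interval (<⇒≤ lo<k) k<hi)

flipAt : ℕ → (ℕ → Bool) → ℕ → Bool
flipAt m f k with k ≟ m
... | yes _ = not (f k)
... | no _ = f k

Flip-flipAt : ∀ m f → Flip m f (flipAt m f)
Flip-flipAt m f = at , off
  where
  at : flipAt m f m ≡ not (f m)
  at with m ≟ m
  ... | yes _ = refl
  ... | no m≢m = contradiction refl m≢m
  off : ∀ k → k ≢ m → flipAt m f k ≡ f k
  off k k≢m with k ≟ m
  ... | yes k≡m = contradiction k≡m k≢m
  ... | no _ = refl

turned-on : ∀ {m f g} → Flip m f g → T (not (f m)) → T (g m)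
turned-on (at , _) t = subst T (sym at) t

turned-off : ∀ {m f g} → Flip m f g → T (f m) → T (not (g m))
turned-off {m} {f} (at , _) t = subst (T ∘ not) (sym at) (subst T (sym (not-involutive (f m))) t)

kept-in : ∀ {m f g k} → Flip m f g → k ≢ m → T (f k) → T (g k)
kept-in (_ , off) k≢m t = subst T (sym (off _ k≢m)) t

kept-out : ∀ {m f g k} → Flip m f g → k ≢ m → T (not (f k)) → T (not (g k))
kept-out (_ , off) k≢m t = subst (T ∘ not) (sym (off _ k≢m)) t

Point : Set
Point = Bool × ℕ

Indicator : Set
Indicator = Point → Bool

rows : (ℕ → Bool) → (ℕ → Bool) → Indicator
rows L U (false , k) = L k
rows L U (true , k) = U k

_≼_ : Point → Point → Set
(r , p) ≼ (r′ , q) = T (rowLeq r r′) × p ≤ q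

rowLeq-refl : ∀ r → T (rowLeq r r)
rowLeq-refl false = tt
rowLeq-refl true = tt

IntervalClosed : Indicator → Set
IntervalClosed P = ∀ {x z y} → x ≼ z → z ≼ y → T (P x) → T (P y) → T (P z)

data Violation (n : ℕ) (P : Indicator) : Set where
  violation : ∀ {x z y} → x ≼ z → z ≼ y → proj₂ y < n →
    T (P x) → T (P y) → T (not (P z)) → Violation n P

rows-closed : ∀ {lL hL lU hU} → hU ≤ suc lL → IntervalClosed (rows [ lL , hL ⟩ [ lU , hU ⟩)
rows-closed _ {false , _} {false , _} {false , _} (_ , p≤q) (_ , q≤s) = interval-convex p≤q q≤s
rows-closed _ {true , _} {true , _} {true , _} (_ , p≤q) (_ , q≤s) = interval-convex p≤q q≤s
rows-closed {lL} {hL} {lU} {hU} hU≤1+lL {false , p} {r , q} {true , s} (_ , p≤q) (_ , q≤s) Px Py =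
  one-column r (≤-antisym p≤q (≤-trans q≤s s≤p)) (≤-antisym q≤s (≤-trans s≤p p≤q))
  where
  -- s < hU ≤ lL + 1 ≤ p + 1, so x, z and y lie in a single column
  s≤p : s ≤ p
  s≤p = ≤-trans (≤-pred (≤-trans (proj₂ (interval-bounds Py)) hU≤1+lL)) (proj₁ (interval-bounds Px))
  one-column : ∀ r → p ≡ q → q ≡ s → T (rows [ lL , hL ⟩ [ lU , hU ⟩ (r , q))
  one-column false refl _ = Px
  one-column true _ refl = Py
rows-closed _ {true , _} {false , _} {_} (() , _)
rows-closed _ {_} {true , _} {false , _} _ (() , _)

record Represents {n} (S : Subset2n n) (P : Indicator) : Set where
  constructor represents
  field mem≡ : ∀ r j → mem S (r , j) ≡ P (r , toℕ j)

represents-cong : ∀ {n} {S : Subset2n n} {P Q} → (∀ x → P x ≡ Q x) → Represents S P → Represents S Q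
represents-cong P≗Q (represents R) = represents λ r j → trans (R r j) (P≗Q _)

represents-unique : ∀ {n} {S S′ : Subset2n n} {P} → Represents S P → Represents S′ P → S ≡ S′
represents-unique {S = lo , up} {lo′ , up′} (represents R) (represents R′) =
  cong₂ _,_ (same-lookups λ j → trans (R false j) (sym (R′ false j)))
            (same-lookups λ j → trans (R true j) (sym (R′ true j)))
  where
  same-lookups : ∀ {n} {v w : Vec Bool n} → (∀ j → lookup v j ≡ lookup w j) → v ≡ w
  same-lookups {v = v} {w} v≗w =
    trans (sym (tabulate∘lookup v)) (trans (tabulate-cong v≗w) (tabulate∘lookup w))

represents-at : ∀ {n} {S : Subset2n n} {P} → Represents S P → ∀ r {p} (p<n : p < n) →
  mem S (r , fromℕ< p<n) ≡ P (r , p)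
represents-at {P = P} (represents R) r p<n =
  trans (R r _) (cong (λ k → P (r , k)) (toℕ-fromℕ< p<n))

FlipAt : Bool → ℕ → Indicator → Indicator → Set
FlipAt r m P Q = Flip m (λ k → P (r , k)) (λ k → Q (r , k)) × (∀ k → Q (not r , k) ≡ P (not r , k))

lower-flip : ∀ {m L L′ U} → Flip m L L′ → FlipAt false m (rows L U) (rows L′ U)
lower-flip fl = fl , λ _ → refl

upper-flip : ∀ {m L U U′} → Flip m U U′ → FlipAt true m (rows L U) (rows L U′)
upper-flip fl = fl , λ _ → refl

some-flip : ∀ r m P → Σ Indicator (FlipAt r m P)
some-flip false m P =
  rows (flipAt m (λ k → P (false , k))) (λ k → P (true , k)) , lower-flip (Flip-flipAt m _)
some-flip true m P =
  rows (λ k → P (false , k)) (flipAt m (λ k → P (true , k))) , upper-flip (Flip-flipAt m _)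

lookup-updateAt-not : ∀ {n} {v : Vec Bool n} {f g x} → (∀ j → lookup v j ≡ f (toℕ j)) →
  Flip (toℕ x) f g → ∀ j → lookup (updateAt v x not) j ≡ g (toℕ j)
lookup-updateAt-not {v = v} {x = x} v≗f (at , off) j with j ≟ᶠ x
... | yes refl = trans (lookup∘updateAt j v) (trans (cong not (v≗f j)) (sym at))
... | no j≢x =
  trans (lookup∘updateAt′ j x j≢x v) (trans (v≗f j) (sym (off _ (j≢x ∘ toℕ-injective))))

represents-flip : ∀ {n} {S : Subset2n n} {P Q r x} → Represents S P → FlipAt r (toℕ x) P Q →
  Represents (flip (r , x) S) Q
represents-flip {S = lo , up} {r = false} (represents R) (fl , other) = represents λ where
  false j → lookup-updateAt-not {v = lo} (R false) fl j
  true j → trans (R true j) (sym (other _))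
represents-flip {S = lo , up} {r = true} (represents R) (fl , other) = represents λ where
  false j → trans (R false j) (sym (other _))
  true j → lookup-updateAt-not {v = up} (R true) fl j

∈-elements : ∀ {n} (x : Elt n) → x ∈ elements n
∈-elements (r , j) = ∈-concatMap⁺ _ (Any.map (λ where refl → column r) (∈-toList⁺ (∈-allFin⁺ j)))
  where
  column : ∀ r → (r , j) ∈ (false , j) ∷ (true , j) ∷ []
  column false = here refl
  column true = there (here refl)

ICS⇒closed : ∀ {n} {S : Subset2n n} → ICS S → ∀ x y z →
  T (mem S x) → T (mem S y) → T (leq x z) → T (leq z y) → T (mem S z)
ICS⇒closed {n} ics x y z x∈ y∈ x≤z z≤y =
  ⇒ᵇ-elim (at (at (at ics x) y) z) (from T-∧ (x∈ , from T-∧ (y∈ , from T-∧ (x≤z , z≤y))))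
  where
  at : ∀ {p : Elt n → Bool} → T (all p (elements n)) → ∀ e → T (p e)
  at t e = All.lookup (all⁺ _ _ t) (∈-elements e)

closed⇒ICS : ∀ {n} {S : Subset2n n} → (∀ x y z →
  T (mem S x) → T (mem S y) → T (leq x z) → T (leq z y) → T (mem S z)) → ICS S
closed⇒ICS {n} {S} closed = everywhere λ x → everywhere λ y → everywhere λ z → ⇒ᵇ-intro λ t →
  let x∈ , t′ = to (T-∧ {mem S x}) t
      y∈ , t″ = to (T-∧ {mem S y}) t′
      x≤z , z≤y = to (T-∧ {leq x z}) t″
  in closed x y z x∈ y∈ x≤z z≤y
  where
  everywhere : ∀ {p : Elt n → Bool} → (∀ e → T (p e)) → T (all p (elements n))
  everywhere {p} t = all⁻ p {elements n} (All.tabulate λ _ → t _)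

leq⇒≼ : ∀ {n r r′} {j j′ : Fin n} → T (leq (r , j) (r′ , j′)) → (r , toℕ j) ≼ (r′ , toℕ j′)
leq⇒≼ {r = r} {r′} {j} {j′} t =
  let r≤r′ , j≤j′ = to (T-∧ {rowLeq r r′}) t in r≤r′ , ≤ᵇ⇒≤ (toℕ j) (toℕ j′) j≤j′

≼⇒leq : ∀ {n r r′ p q} (p<n : p < n) (q<n : q < n) → (r , p) ≼ (r′ , q) →
  T (leq (r , fromℕ< p<n) (r′ , fromℕ< q<n))
≼⇒leq p<n q<n (r≤r′ , p≤q) =
  from T-∧ (r≤r′ , ≤⇒≤ᵇ (subst₂ _≤_ (sym (toℕ-fromℕ< p<n)) (sym (toℕ-fromℕ< q<n)) p≤q))

represents-ICS : ∀ {n} {S : Subset2n n} {P} → Represents S P → IntervalClosed P → ICS S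
represents-ICS (represents R) closed = closed⇒ICS λ where
  (r₁ , j₁) (r₂ , j₂) (r₃ , j₃) x∈ y∈ x≤z z≤y → subst T (sym (R r₃ j₃))
    (closed (leq⇒≼ x≤z) (leq⇒≼ z≤y) (subst T (R r₁ j₁) x∈) (subst T (R r₂ j₂) y∈))

represents-¬ICS : ∀ {n} {S : Subset2n n} {P} → Represents S P → Violation n P → ¬ ICS S
represents-¬ICS R (violation {r₁ , p₁} {r₃ , p₃} {r₂ , p₂} x≼z z≼y p₂<n Px Py ¬Pz) ics =
  T-not⇒¬T ¬Pz (subst T (represents-at R r₃ p₃<n) (ICS⇒closed ics x y z
    (subst T (sym (represents-at R r₁ p₁<n)) Px) (subst T (sym (represents-at R r₂ p₂<n)) Py)
    (≼⇒leq p₁<n p₃<n x≼z) (≼⇒leq p₃<n p₂<n z≼y)))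
  where
  p₃<n = ≤-<-trans (proj₂ z≼y) p₂<n
  p₁<n = ≤-<-trans (proj₂ x≼z) p₃<n
  x = r₁ , fromℕ< p₁<n
  y = r₂ , fromℕ< p₂<n
  z = r₃ , fromℕ< p₃<n

toggle-accepted : ∀ {n} e (S : Subset2n n) → ICS (flip e S) → toggle e S ≡ flip e S
toggle-accepted e S ics rewrite to T-≡ ics = refl

toggle-rejected : ∀ {n} e (S : Subset2n n) → ¬ ICS (flip e S) → toggle e S ≡ S
toggle-rejected e S ¬ics rewrite ¬-not (¬ics ∘ from T-≡) = refl

record Toggles (n : ℕ) (r : Bool) (m : ℕ) (P Q : Indicator) : Set where
  constructor toggles
  field run : ∀ {S : Subset2n n} {x} → toℕ x ≡ m → Represents S P → Represents (toggle (r , x) S) Q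

toggle-accept : ∀ {n r m P Q} → FlipAt r m P Q → IntervalClosed Q → Toggles n r m P Q
toggle-accept {n} {r} {m} {P} {Q} fl closed = toggles accept
  where
  accept : ∀ {S : Subset2n n} {x} → toℕ x ≡ m → Represents S P → Represents (toggle (r , x) S) Q
  accept {S} {x} refl R =
    subst (λ S′ → Represents S′ Q) (sym (toggle-accepted (r , x) S (represents-ICS R′ closed))) R′
    where R′ = represents-flip R fl

record Rejects (n : ℕ) (r : Bool) (m : ℕ) (P : Indicator) : Set where
  constructor rejects
  field violated : ∀ Q → FlipAt r m P Q → Violation n Q

toggle-reject : ∀ {n r m P} → Rejects n r m P → Toggles n r m P P
toggle-reject {n} {r} {m} {P} (rejects violated) = toggles reject
  where
  reject : ∀ {S : Subset2n n} {x} → toℕ x ≡ m → Represents S P → Represents (toggle (r , x) S) P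
  reject {S} {x} refl R with some-flip r (toℕ x) P
  ... | Q , fl = subst (λ S′ → Represents S′ P) (sym (toggle-rejected (r , x) S ¬ICS)) R
    where ¬ICS = represents-¬ICS (represents-flip R fl) (violated Q fl)

rejects-upper-above : ∀ {n c m P} → c < m → m < n →
  T (P (false , c)) → T (not (P (true , c))) → T (not (P (true , m))) → Rejects n true m P
rejects-upper-above c<m m<n Pc ¬P′c ¬Pm = rejects λ Q (fl , other) →
  violation {x = false , _} {true , _} {true , _} (tt , ≤-refl) (tt , <⇒≤ c<m) m<n
    (subst T (sym (other _)) Pc) (turned-on fl ¬Pm) (kept-out fl (<⇒≢ c<m) ¬P′c)

rejects-lower-below : ∀ {n c m P} → m < c → c < n →
  T (not (P (false , m))) → T (not (P (false , c))) → T (P (true , c)) → Rejects n false m P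
rejects-lower-below m<c c<n ¬Pm ¬Pc P′c = rejects λ Q (fl , other) →
  violation {x = false , _} {false , _} {true , _} (tt , <⇒≤ m<c) (tt , ≤-refl) c<n
    (turned-on fl ¬Pm) (subst T (sym (other _)) P′c) (kept-out fl (>⇒≢ m<c) ¬Pc)

rejects-isolated-above : ∀ {n r c q m P} → c ≤ q → q < m → m < n →
  T (P (r , c)) → T (not (P (r , q))) → T (not (P (r , m))) → Rejects n r m P
rejects-isolated-above {r = r} c≤q q<m m<n Pc ¬Pq ¬Pm = rejects λ Q (fl , _) →
  violation {x = r , _} {r , _} {r , _} (rowLeq-refl r , c≤q) (rowLeq-refl r , <⇒≤ q<m) m<n
    (kept-in fl (<⇒≢ (≤-<-trans c≤q q<m)) Pc) (turned-on fl ¬Pm) (kept-out fl (<⇒≢ q<m) ¬Pq)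

rejects-isolated-below : ∀ {n r c q m P} → m < q → q < c → c < n →
  T (P (r , c)) → T (not (P (r , q))) → T (not (P (r , m))) → Rejects n r m P
rejects-isolated-below {r = r} m<q q<c c<n Pc ¬Pq ¬Pm = rejects λ Q (fl , _) →
  violation {x = r , _} {r , _} {r , _} (rowLeq-refl r , <⇒≤ m<q) (rowLeq-refl r , <⇒≤ q<c) c<n
    (turned-on fl ¬Pm) (kept-in fl (>⇒≢ (<-trans m<q q<c)) Pc) (kept-out fl (>⇒≢ m<q) ¬Pq)

rejects-split : ∀ {n r c q m P} → c < m → m < q → q < n →
  T (P (r , c)) → T (P (r , q)) → T (P (r , m)) → Rejects n r m P
rejects-split {r = r} c<m m<q q<n Pc Pq Pm = rejects λ Q (fl , _) →
  violation {x = r , _} {r , _} {r , _} (rowLeq-refl r , <⇒≤ c<m) (rowLeq-refl r , <⇒≤ m<q) q<n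
    (kept-in fl (<⇒≢ c<m) Pc) (kept-in fl (>⇒≢ m<q) Pq) (turned-off fl Pm)

column : ∀ {n} → Fin n → Subset2n n → Subset2n n
column x S = toggle (false , x) (toggle (true , x) S)

ColumnStep : ℕ → ℕ → Indicator → Indicator → Set
ColumnStep n m P Q = ∀ {S : Subset2n n} {x} → toℕ x ≡ m → Represents S P → Represents (column x S) Q

upper-then-lower : ∀ {n m P Q R} → Toggles n true m P Q → Toggles n false m Q R → ColumnStep n m P R
upper-then-lower upper lower x≡m = Toggles.run lower x≡m ∘ Toggles.run upper x≡m

data Columns {n : ℕ} : ℕ → ℕ → List (Fin n) → Set where
  [] : ∀ {j} → Columns j j []
  _∷_ : ∀ {j e x xs} → toℕ x ≡ j → Columns (suc j) e xs → Columns j e (x ∷ xs)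

columns-≤ : ∀ {n j e} {xs : List (Fin n)} → Columns j e xs → j ≤ e
columns-≤ [] = ≤-refl
columns-≤ (_ ∷ cs) = ≤-trans (n≤1+n _) (columns-≤ cs)

columns-split : ∀ {n j m e} {xs : List (Fin n)} → j ≤ m → m ≤ e → Columns j e xs →
  Σ (List (Fin n)) λ ys → Σ (List (Fin n)) λ zs → xs ≡ ys ++ zs × Columns j m ys × Columns m e zs
columns-split j≤m m≤j [] with ≤-antisym j≤m m≤j
... | refl = [] , [] , refl , [] , []
columns-split {xs = x ∷ xs} j≤m m≤e (x≡j ∷ cs) with m≤n⇒m<n∨m≡n j≤m
... | inj₂ refl = [] , x ∷ xs , refl , [] , x≡j ∷ cs
... | inj₁ j<m with columns-split j<m m≤e cs
...   | ys , zs , refl , cs₁ , cs₂ = x ∷ ys , zs , refl , x≡j ∷ cs₁ , cs₂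

columns-tabulate : ∀ {n} k j (f : Fin k → Fin n) → (∀ y → toℕ (f y) ≡ j + toℕ y) →
  Columns j (j + k) (toList (tabulate f))
columns-tabulate {n} zero j f _ = subst (λ e → Columns {n} j e []) (sym (+-identityʳ j)) []
columns-tabulate {n} (suc k) j f f≗j+ =
  trans (f≗j+ _) (+-identityʳ j) ∷
  subst (λ e → Columns (suc j) e (toList (tabulate (f ∘ Fin.suc)))) (sym (+-suc j k))
    (columns-tabulate k (suc j) (f ∘ Fin.suc) λ y → trans (f≗j+ _) (+-suc j _))

columns-allFin : ∀ n → Columns 0 n (toList (allFin n))
columns-allFin n = columns-tabulate n 0 (λ y → y) λ _ → refl

sweepColumns : ∀ {n} → List (Fin n) → Subset2n n → Subset2n n
sweepColumns xs = toggleSeq (concatMap (λ j → (false , j) ∷ (true , j) ∷ []) xs)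

sweepColumns-++ : ∀ {n} (ys zs : List (Fin n)) S →
  sweepColumns (ys ++ zs) S ≡ sweepColumns ys (sweepColumns zs S)
sweepColumns-++ [] zs S = refl
sweepColumns-++ (y ∷ ys) zs S = cong (column y) (sweepColumns-++ ys zs S)

-- toggleSeq acts from the end of its list: a sweep over the columns j … e - 1
-- starts at column e - 1, in state P, and ends after column j, in state Q.
Sweep : ℕ → ℕ → ℕ → Indicator → Indicator → Set
Sweep n j e P Q =
  ∀ {xs} → Columns j e xs → ∀ {S : Subset2n n} → Represents S P → Represents (sweepColumns xs S) Q

sweep : ∀ {n j e} (F : ℕ → Indicator) →
  (∀ {m} → j ≤ m → m < e → ColumnStep n m (F (suc m)) (F m)) → Sweep n j e (F e) (F j)
sweep F step [] R = R
sweep F step (x≡j ∷ cs) R =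
  step ≤-refl (columns-≤ cs) x≡j (sweep F (λ j<m m<e → step (<⇒≤ j<m) m<e) cs R)

sweep-const : ∀ {n j e P} → (∀ {m} → j ≤ m → m < e → ColumnStep n m P P) → Sweep n j e P P
sweep-const {P = P} = sweep (λ _ → P)

sweep-single : ∀ {n j P Q} → ColumnStep n j P Q → Sweep n j (suc j) P Q
sweep-single step (x≡j ∷ []) R = step x≡j R
sweep-single step (_ ∷ (_ ∷ cs)) R = contradiction (columns-≤ cs) (<⇒≱ ≤-refl)

sweep-compose : ∀ {n j m e P Q R} → j ≤ m → m ≤ e →
  Sweep n m e P Q → Sweep n j m Q R → Sweep n j e P R
sweep-compose {R = R} j≤m m≤e upper lower cs {S} RP with columns-split j≤m m≤e cs
... | ys , zs , refl , cs₁ , cs₂ =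
  subst (λ S′ → Represents S′ R) (sym (sweepColumns-++ ys zs S)) (lower cs₁ (upper cs₂ RP))

sweep-through : ∀ {n j h e P Q} → j ≤ h → h < e →
  (∀ {m} → h < m → m < e → ColumnStep n m P P) → ColumnStep n h P Q →
  (∀ {m} → j ≤ m → m < h → ColumnStep n m Q Q) → Sweep n j e P Q
sweep-through j≤h h<e above at below =
  sweep-compose j≤h (<⇒≤ h<e)
    (sweep-compose (n≤1+n _) h<e (sweep-const above) (sweep-single at))
    (sweep-const below)

row-sweep : ∀ {n P Q} → Sweep n 0 n P Q → ∀ {S} → Represents S P → Represents (Row S) Q
row-sweep {n} sw = sw (columns-allFin n)

module _ {n : ℕ} where

  upper-blocked : ∀ {c d m L} → c < m → m < n → T (L c) →
    Toggles n true m (rows L [ d , c ⟩) (rows L [ d , c ⟩)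
  upper-blocked c<m m<n Lc = toggle-reject
    (rejects-upper-above c<m m<n Lc (∉-interval-above ≤-refl) (∉-interval-above (<⇒≤ c<m)))

  lower-blocked : ∀ {c h m U} → m < c → c < n → T (U c) →
    Toggles n false m (rows [ suc c , h ⟩ U) (rows [ suc c , h ⟩ U)
  lower-blocked m<c c<n Uc = toggle-reject
    (rejects-lower-below m<c c<n (∉-interval-below (m<n⇒m<1+n m<c)) (∉-interval-below ≤-refl) Uc)

  top-extend : ∀ {c h d} → c < h → h < n →
    Sweep n (suc c) n (rows [ c , h ⟩ [ d , c ⟩) (rows [ c , suc h ⟩ [ d , c ⟩)
  top-extend {c} {h} {d} c<h h<n = sweep-through c<h h<n above at below
    where
    P = rows [ c , h ⟩ [ d , c ⟩
    Q = rows [ c , suc h ⟩ [ d , c ⟩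
    c∈P = ∈-interval ≤-refl c<h
    c∈Q = ∈-interval ≤-refl (m<n⇒m<1+n c<h)
    above : ∀ {m} → h < m → m < n → ColumnStep n m P P
    above h<m m<n = upper-then-lower (upper-blocked (<-trans c<h h<m) m<n c∈P) (toggle-reject
      (rejects-isolated-above (<⇒≤ c<h) h<m m<n
        c∈P (∉-interval-above ≤-refl) (∉-interval-above (<⇒≤ h<m))))
    at : ColumnStep n h P Q
    at = upper-then-lower (upper-blocked c<h h<n c∈P)
      (toggle-accept (lower-flip (flip-top (<⇒≤ c<h))) (rows-closed (n≤1+n c)))
    below : ∀ {m} → c < m → m < h → ColumnStep n m Q Q
    below c<m m<h = upper-then-lower (upper-blocked c<m (<-trans m<h h<n) c∈Q) (toggle-reject
      (rejects-split c<m m<h h<n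
        c∈Q (∈-interval (<⇒≤ c<h) ≤-refl) (∈-interval (<⇒≤ c<m) (m<n⇒m<1+n m<h))))

  top-shrink : ∀ {c h d} → c < h → h ≡ n →
    Sweep n (suc c) n (rows [ c , h ⟩ [ d , c ⟩) (rows [ c , suc c ⟩ [ d , c ⟩)
  top-shrink {c} {d = d} c<n refl = sweep (λ m → rows [ c , m ⟩ [ d , c ⟩) λ c<m m<n →
    upper-then-lower (upper-blocked c<m m<n (∈-interval ≤-refl (m<n⇒m<1+n c<m)))
      (toggle-accept (lower-flip (Flip-sym (flip-top (<⇒≤ c<m)))) (rows-closed (n≤1+n c)))

  middle-column : ∀ {c h d} → c < h → d ≤ c →
    ColumnStep n c (rows [ c , h ⟩ [ d , c ⟩) (rows [ suc c , h ⟩ [ d , suc c ⟩)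
  middle-column c<h d≤c = upper-then-lower
    (toggle-accept (upper-flip (flip-top d≤c)) (rows-closed ≤-refl))
    (toggle-accept (lower-flip (Flip-sym (flip-bottom c<h))) (rows-closed (n≤1+n _)))

  bottom-shift : ∀ {c h d} → d < c → c < n →
    Sweep n 0 c (rows [ suc c , h ⟩ [ d , suc c ⟩) (rows [ suc c , h ⟩ [ suc d , suc c ⟩)
  bottom-shift {c} {h} {d} d<c c<n = sweep-through z≤n d<c above at below
    where
    P = rows [ suc c , h ⟩ [ d , suc c ⟩
    Q = rows [ suc c , h ⟩ [ suc d , suc c ⟩
    c∈P = ∈-interval (<⇒≤ d<c) ≤-refl
    c∈Q = ∈-interval d<c ≤-refl
    above : ∀ {m} → d < m → m < c → ColumnStep n m P P
    above d<m m<c = upper-then-lower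
      (toggle-reject (rejects-split d<m m<c c<n
        (∈-interval ≤-refl (m<n⇒m<1+n d<c)) c∈P (∈-interval (<⇒≤ d<m) (m<n⇒m<1+n m<c))))
      (lower-blocked m<c c<n c∈P)
    at : ColumnStep n d P Q
    at = upper-then-lower
      (toggle-accept (upper-flip (Flip-sym (flip-bottom (m<n⇒m<1+n d<c)))) (rows-closed (n≤1+n _)))
      (lower-blocked d<c c<n c∈Q)
    below : ∀ {m} → 0 ≤ m → m < d → ColumnStep n m Q Q
    below _ m<d = upper-then-lower
      (toggle-reject (rejects-isolated-below m<d d<c c<n
        c∈Q (∉-interval-below ≤-refl) (∉-interval-below (m<n⇒m<1+n m<d))))
      (lower-blocked (<-trans m<d d<c) c<n c∈Q)

  bottom-fill : ∀ {c h} → c < n →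
    Sweep n 0 c (rows [ suc c , h ⟩ [ c , suc c ⟩) (rows [ suc c , h ⟩ [ 0 , suc c ⟩)
  bottom-fill {c} {h} c<n = sweep (λ m → rows [ suc c , h ⟩ [ m , suc c ⟩) λ _ m<c →
    upper-then-lower
      (toggle-accept (upper-flip (flip-bottom (m<n⇒m<1+n m<c))) (rows-closed (n≤1+n _)))
      (lower-blocked m<c c<n (∈-interval (<⇒≤ m<c) ≤-refl))

  rowmotion-through : ∀ {c P Q R U} → c < n →
    Sweep n (suc c) n P Q → ColumnStep n c Q R → Sweep n 0 c R U →
    ∀ {S} → Represents S P → Represents (Row S) U
  rowmotion-through c<n top middle bottom = row-sweep
    (sweep-compose z≤n (<⇒≤ c<n) (sweep-compose (n≤1+n _) c<n top (sweep-single middle)) bottom)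

lowSet-represents : ∀ b i a → Represents (lowSet b i a) (rows [ b , b + i ⟩ [ b , b ⟩)
lowSet-represents b i a = represents λ where
  false j → lookup-intervalVec _ b i j
  true j → trans (lookup∘tabulate _ j) (sym (empty-interval b (toℕ j)))

highSet-represents : ∀ n b i → Represents (highSet n b i) (rows (λ _ → false) [ b , b + i ⟩)
highSet-represents n b i = represents λ where
  false j → lookup∘tabulate _ j
  true j → lookup-intervalVec n b i j

represents-empty-lower : ∀ {n} {S : Subset2n n} {m U} →
  Represents S (rows [ m , m ⟩ U) → Represents S (rows (λ _ → false) U)
represents-empty-lower {m = m} = represents-cong λ where
  (false , k) → empty-interval m k
  (true , k) → refl

present⇒¬absent : ∀ {n} {S : Subset2n n} {P r p} → Represents S P → p < n → T (P (r , p)) →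
  ¬ T (all (λ j → not (mem S (r , j))) (toList (allFin n)))
present⇒¬absent {r = r} R p<n Pp absent =
  T-not⇒¬T (All.lookup (all⁺ _ _ absent) (∈-toList⁺ (∈-allFin⁺ (fromℕ< p<n))))
    (subst T (sym (represents-at R r p<n)) Pp)

shift-identity : ∀ t b i → t + suc b + i ≡ b + i + suc t
shift-identity = solve-∀

orbit-bound : ∀ {b i a t} → suc t ≤ a → t + suc b + i ≤ b + i + a
orbit-bound {b} {i} {a} {t} 1+t≤a =
  subst (_≤ b + i + a) (sym (shift-identity t b i)) (+-monoʳ-≤ (b + i) 1+t≤a)

orbit : ∀ {b i a} → 1 ≤ i → ∀ t → t < a →
  Represents (iter (suc t) Row (lowSet b i a)) (rows [ t + suc b , t + suc b + i ⟩ [ t , t + suc b ⟩)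
orbit {b} {i} {a} 1≤i zero 0<a =
  rowmotion-through b<n
    (top-extend b<b+i b+i<n) (middle-column (m<n⇒m<1+n b<b+i) ≤-refl) (bottom-fill b<n)
    (lowSet-represents b i a)
  where
  b<b+i = m<m+n b 1≤i
  b+i<n = orbit-bound {b} {i} {a} {0} 0<a
  b<n = <-trans b<b+i b+i<n
orbit {b} {i} {a} 1≤i (suc t) 1+t<a =
  rowmotion-through c<n
    (top-extend c<c+i c+i<n) (middle-column (m<n⇒m<1+n c<c+i) (<⇒≤ t<c)) (bottom-shift t<c c<n)
    (orbit 1≤i t (<-trans (n<1+n t) 1+t<a))
  where
  c = t + suc b
  c<c+i = m<m+n c 1≤i
  c+i<n = orbit-bound {b} {i} {a} {suc t} 1+t<a
  c<n = <-trans c<c+i c+i<n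
  t<c = m<m+n t z<s

orbit-end : ∀ {b i a} → 1 ≤ i →
  Represents (iter (suc a) Row (lowSet b i a)) (rows (λ _ → false) [ a , a + suc b ⟩)
orbit-end {b} {i} {zero} 1≤i = represents-empty-lower
  (rowmotion-through b<n
    (top-shrink b<b+i (sym (+-identityʳ (b + i)))) (middle-column (n<1+n b) ≤-refl) (bottom-fill b<n)
    (lowSet-represents b i 0))
  where
  b<b+i = m<m+n b 1≤i
  b<n = <-≤-trans b<b+i (≤-reflexive (sym (+-identityʳ (b + i))))
orbit-end {b} {i} {suc t} 1≤i = represents-empty-lower
  (rowmotion-through c<n
    (top-shrink c<c+i (shift-identity t b i)) (middle-column (n<1+n c) (<⇒≤ t<c)) (bottom-shift t<c c<n)
    (orbit 1≤i t (n<1+n t)))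
  where
  c = t + suc b
  c<c+i = m<m+n c 1≤i
  c<n = <-≤-trans c<c+i (orbit-bound {b} {i} {suc t} {t} ≤-refl)
  t<c = m<m+n t z<s

orbit-mixed : ∀ {b i a t} → 1 ≤ i → t < a →
  ¬ HighICS (iter (suc t) Row (lowSet b i a)) × ¬ LowICS (iter (suc t) Row (lowSet b i a))
orbit-mixed {b} {i} {a} {t} 1≤i t<a =
  (λ (_ , _ , inUpper) → present⇒¬absent {r = false} R c<n (∈-interval ≤-refl c<c+i) inUpper) ,
  (λ (_ , _ , inLower) → present⇒¬absent {r = true} R (<-trans t<c c<n) (∈-interval ≤-refl t<c) inLower)
  where
  R = orbit 1≤i t t<a
  c = t + suc b
  c<c+i = m<m+n c 1≤i
  c<n = <-≤-trans c<c+i (orbit-bound {b} {i} {a} {t} t<a)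
  t<c = m<m+n t z<s

proposition3p20 : (b i a : ℕ) → 1 ≤ i →
    (iter (suc a) Row (lowSet b i a) ≡ highSet (b + i + a) a (suc b))
    × ((k : ℕ) → 1 ≤ k → k ≤ a →
         ¬ HighICS (iter k Row (lowSet b i a)) × ¬ LowICS (iter k Row (lowSet b i a)))
proposition3p20 b i a 1≤i =
  represents-unique (orbit-end 1≤i) (highSet-represents _ a (suc b)) ,
  λ where (suc t) _ 1+t≤a → orbit-mixed {b} 1≤i 1+t≤a
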